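{- Let $g\ge 5$ be an integer. Every positive integer with exactly four base $g$ digits is a sum of three base $g$ palindromes.
   Context: Every nonnegative integer has a unique base $g$ representation $\delta_{l-1}\cdots\delta_0$ with digits $0\le \delta_j\le g-1$ and $\delta_{l-1}\ne 0$; it is a base $g$ palindrome if $\delta_{l-i}=\delta_{i-1}$ for all $i=1,\dots,\lfloor l/2\rfloor$. By convention $0$ is also considered a base $g$ palindrome. -}

module Defs where

open import Data.Nat using (ℕ; zero; suc; _≤_; _<_; _^_; _/_; _%_)
open import Data.List using (List; []; _∷_; reverse)
open import Relation.Binary.PropositionalEquality using (_≡_)

-- Base-g digits of n, least significant first, with no leading zeros
-- (so the digit list of 0 is empty).  The fuel argument bounds the
-- recursion; fuel n suffices for g ≥ 2 since n / g < n for n > 0.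
digitsAux : (g : ℕ) → .{{_ : Data.Nat.NonZero g}} → ℕ → ℕ → List ℕ
digitsAux g zero    n = []
digitsAux g (suc k) zero = []
digitsAux g (suc k) n@(suc _) = (n % g) ∷ digitsAux g k (n / g)

digits : (g : ℕ) → .{{_ : Data.Nat.NonZero g}} → ℕ → List ℕ
digits g n = digitsAux g n n

-- n is a base-g palindrome: its digit string reads the same both ways.
-- (0 has the empty digit list, so it is a palindrome, matching the convention.)
IsPalindrome : (g : ℕ) → .{{_ : Data.Nat.NonZero g}} → ℕ → Set
IsPalindrome g n = reverse (digits g n) ≡ digits g n

-- Write n = ABCD in base g.  Apart from a few numbers with leading digit 1, which are
-- split by hand, n = pqqp + x0x + N with palindromes pqqp, x0x and 0 ≤ N < g²; the
-- high digit of N then moves into the middle of x0x, leaving a one-digit remainder.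
-- The digits p, q, x are read off from how B compares with C + 3 and A + B with the
-- two-digit number CD, borrowing one from A (p = A − 1) when neither comparison helps.

module Submission where

open import Defs
open import Data.Nat using (ℕ; zero; suc; NonZero; _+_; _*_; _≤_; _<_; _^_; _/_; _%_; z≤n; s≤s; z<s; _≤?_)
open import Data.Nat.Properties
open import Data.Nat.DivMod
open import Data.Nat.Divisibility using (m∣m*n)
open import Data.List using (List; []; _∷_; reverse; length)
open import Data.Product using (∃-syntax; _×_; _,_)
open import Data.Unit using (⊤; tt)
open import Data.Nat.Tactic.RingSolver using (solve-∀)
open import Relation.Nullary using (yes; no; contradiction)
open import Relation.Binary.PropositionalEquality using (_≡_; refl; sym; trans; cong; cong₂; subst; module ≡-Reasoning)

fromDigits : ℕ → List ℕ → ℕ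
fromDigits g []       = 0
fromDigits g (d ∷ ds) = d + g * fromDigits g ds

module _ (g : ℕ) .{{_ : NonZero g}} where

  CanonicalDigits : List ℕ → Set
  CanonicalDigits []           = ⊤
  CanonicalDigits (d ∷ [])     = d < g × 0 < d
  CanonicalDigits (d ∷ e ∷ ds) = d < g × CanonicalDigits (e ∷ ds)

  head<g : ∀ d ds → CanonicalDigits (d ∷ ds) → d < g
  head<g d []      (d<g , _) = d<g
  head<g d (_ ∷ _) (d<g , _) = d<g

  tail-canonical : ∀ d ds → CanonicalDigits (d ∷ ds) → CanonicalDigits ds
  tail-canonical d []      _        = tt
  tail-canonical d (_ ∷ _) (_ , c)  = c

  fromDigits-pos : ∀ d ds → CanonicalDigits (d ∷ ds) → 0 < fromDigits g (d ∷ ds)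
  fromDigits-pos d []       (_ , 0<d) = <-≤-trans 0<d (m≤m+n d _)
  fromDigits-pos d (e ∷ ds) (_ , c)   =
    <-≤-trans (m<n⇒m<o*n g (fromDigits-pos e ds c)) (m≤n+m _ d)

  [d+g*v]%g≡d : ∀ {d} v → d < g → (d + g * v) % g ≡ d
  [d+g*v]%g≡d {d} v d<g = trans (%-remove-+ʳ d (m∣m*n v)) (m<n⇒m%n≡m d<g)

  [d+g*v]/g≡v : ∀ {d} v → d < g → (d + g * v) / g ≡ v
  [d+g*v]/g≡v {d} v d<g = begin
    (d + g * v) / g    ≡⟨ +-distrib-/-∣ʳ d (m∣m*n v) ⟩
    d / g + g * v / g  ≡⟨ cong₂ _+_ (m<n⇒m/n≡0 d<g) (cong (_/ g) (*-comm g v)) ⟩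
    v * g / g          ≡⟨ m*n/n≡m v g ⟩
    v                  ∎
    where open ≡-Reasoning

  digitsAux-suc : ∀ k n → 0 < n → digitsAux g (suc k) n ≡ n % g ∷ digitsAux g k (n / g)
  digitsAux-suc k (suc n) _ = refl

  digitsAux-fromDigits : ∀ L k → CanonicalDigits L → length L ≤ k → digitsAux g k (fromDigits g L) ≡ L
  digitsAux-fromDigits []       zero    _ _ = refl
  digitsAux-fromDigits []       (suc k) _ _ = refl
  digitsAux-fromDigits (d ∷ ds) (suc k) c (s≤s len≤k) = begin
    digitsAux g (suc k) (d + g * v)                 ≡⟨ digitsAux-suc k _ (fromDigits-pos d ds c) ⟩
    (d + g * v) % g ∷ digitsAux g k ((d + g * v) / g) ≡⟨ cong₂ _∷_ ([d+g*v]%g≡d v d<g) (cong (digitsAux g k) ([d+g*v]/g≡v v d<g)) ⟩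
    d ∷ digitsAux g k v                             ≡⟨ cong (d ∷_) (digitsAux-fromDigits ds k (tail-canonical d ds c) len≤k) ⟩
    d ∷ ds                                          ∎
    where
    open ≡-Reasoning
    v = fromDigits g ds
    d<g = head<g d ds c

  module _ (1<g : 1 < g) where

    length≤fromDigits : ∀ L → CanonicalDigits L → length L ≤ fromDigits g L
    length≤fromDigits []           _         = z≤n
    length≤fromDigits (d ∷ [])     (_ , 0<d) = ≤-trans 0<d (m≤m+n d _)
    length≤fromDigits (d ∷ e ∷ ds) (_ , c)   = begin
      suc (length (e ∷ ds))  ≤⟨ s≤s (length≤fromDigits (e ∷ ds) c) ⟩
      suc v                  ≤⟨ +-monoˡ-≤ v (fromDigits-pos e ds c) ⟩
      v + v                  ≡⟨ cong (v +_) (sym (+-identityʳ v)) ⟩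
      2 * v                  ≤⟨ *-monoˡ-≤ v 1<g ⟩
      g * v                  ≤⟨ m≤n+m _ d ⟩
      d + g * v              ∎
      where
      open ≤-Reasoning
      v = fromDigits g (e ∷ ds)

    digits-fromDigits : ∀ L → CanonicalDigits L → digits g (fromDigits g L) ≡ L
    digits-fromDigits L c = digitsAux-fromDigits L (fromDigits g L) c (length≤fromDigits L c)

    fromDigits-palindrome : ∀ L → CanonicalDigits L → reverse L ≡ L → IsPalindrome g (fromDigits g L)
    fromDigits-palindrome L c rev = subst (λ ds → reverse ds ≡ ds) (sym (digits-fromDigits L c)) rev

    private
      d+g*0≡d : ∀ d → d + g * 0 ≡ d
      d+g*0≡d d = trans (cong (d +_) (*-zeroʳ g)) (+-identityʳ d)

    digit-palindrome : ∀ {d} → d < g → IsPalindrome g d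
    digit-palindrome {zero}  _   = refl
    digit-palindrome {suc d} d<g =
      subst (IsPalindrome g) (d+g*0≡d (suc d)) (fromDigits-palindrome (suc d ∷ []) (d<g , s≤s z≤n) refl)

    palindrome₂ : ∀ {d} → 0 < d → d < g → IsPalindrome g (d + g * d)
    palindrome₂ {d} 0<d d<g =
      subst (λ m → IsPalindrome g (d + g * m)) (d+g*0≡d d)
        (fromDigits-palindrome (d ∷ d ∷ []) (d<g , d<g , 0<d) refl)

    palindrome₃ : ∀ {x y} → 0 < x → x < g → y < g → IsPalindrome g (x + g * (y + g * x))
    palindrome₃ {x} {y} 0<x x<g y<g =
      subst (λ m → IsPalindrome g (x + g * (y + g * m))) (d+g*0≡d x)
        (fromDigits-palindrome (x ∷ y ∷ x ∷ []) (x<g , y<g , x<g , 0<x) refl)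

    palindrome₄ : ∀ {p q} → 0 < p → p < g → q < g → IsPalindrome g (p + g * (q + g * (q + g * p)))
    palindrome₄ {p} {q} 0<p p<g q<g =
      subst (λ m → IsPalindrome g (p + g * (q + g * (q + g * m)))) (d+g*0≡d p)
        (fromDigits-palindrome (p ∷ q ∷ q ∷ p ∷ []) (p<g , q<g , q<g , p<g , 0<p) refl)

SumOfThreePalindromes : (g : ℕ) → .{{NonZero g}} → ℕ → Set
SumOfThreePalindromes g n =
  ∃[ a ] ∃[ b ] ∃[ c ] (IsPalindrome g a × IsPalindrome g b × IsPalindrome g c × n ≡ a + b + c)

cancel-offset : ∀ {n s t m e} → n + s ≡ m + t → s + e ≡ t → n ≡ m + e
cancel-offset {n} {s} {t} {m} {e} eq s+e≡t = +-cancelʳ-≡ s n (m + e) (begin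
  n + s        ≡⟨ eq ⟩
  m + t        ≡⟨ cong (m +_) (sym s+e≡t) ⟩
  m + (s + e)  ≡⟨ cong (m +_) (+-comm s e) ⟩
  m + (e + s)  ≡⟨ sym (+-assoc m e s) ⟩
  m + e + s    ∎)
  where open ≡-Reasoning

x0x+ye≡xyx+e : ∀ g m x y e → m + (x + g * (0 + g * x)) + (e + y * g) ≡ m + (x + g * (y + g * x)) + e
x0x+ye≡xyx+e = solve-∀

d+g*m<g*n : ∀ {g d m n} → d < g → m < n → d + g * m < g * n
d+g*m<g*n {g} {d} {m} {n} d<g m<n = begin-strict
  d + g * m      <⟨ +-monoˡ-< (g * m) d<g ⟩
  g + g * m      ≡⟨ *-suc g m ⟨
  g * suc m      ≤⟨ *-monoʳ-≤ g m<n ⟩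
  g * n          ∎
  where open ≤-Reasoning

d+g*m<g*n⇒m<n : ∀ {g d m n} → d + g * m < g * n → m < n
d+g*m<g*n⇒m<n {g} {d} {m} {n} lt = *-cancelˡ-< g m n (≤-<-trans (m≤n+m (g * m) d) lt)

module _ {g : ℕ} .{{_ : NonZero g}} where

  m≡m%g+g*[m/g] : ∀ m → m ≡ m % g + g * (m / g)
  m≡m%g+g*[m/g] m = trans (m≡m%n+[m/n]*n m g) (cong (m % g +_) (*-comm (m / g) g))

  m<g*n⇒m/g<n : ∀ {m n} → m < g * n → m / g < n
  m<g*n⇒m/g<n {m} {n} m<g*n = m<n*o⇒m/o<n (subst (m <_) (*-comm g n) m<g*n)

  g*n≤m⇒n≤m/g : ∀ {m n} → g * n ≤ m → n ≤ m / g
  g*n≤m⇒n≤m/g {m} {n} g*n≤m =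
    subst (_≤ m / g) (trans (cong (_/ g) (*-comm g n)) (m*n/n≡m n g)) (/-monoˡ-≤ g g*n≤m)

module _ (g : ℕ) .{{_ : NonZero g}} (1<g : 1 < g) where

  -- N = t ∸ s is passed as offsets s ≤ t, so that the defining identity of each case is
  -- a polynomial identity without truncated subtraction.
  via-pqqp+x0x : ∀ {n p q x s t} → 0 < p → p < g → q < g → 0 < x → x < g → s ≤ t → t < s + g * g →
                 n + s ≡ (p + g * (q + g * (q + g * p))) + (x + g * (0 + g * x)) + t →
                 SumOfThreePalindromes g n
  via-pqqp+x0x {n} {p} {q} {x} {s} {t} 0<p p<g q<g 0<x x<g s≤t t<s+g*g eq with m≤n⇒∃[o]m+o≡n s≤t
  ... | N , s+N≡t =
    P , x + g * (N / g + g * x) , N % g ,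
    palindrome₄ g 1<g 0<p p<g q<g , palindrome₃ g 1<g 0<x x<g (m<n*o⇒m/o<n N<g*g) ,
    digit-palindrome g 1<g (m%n<n N g) ,
    (begin
      n                                          ≡⟨ cancel-offset eq s+N≡t ⟩
      P + (x + g * (0 + g * x)) + N              ≡⟨ cong (P + (x + g * (0 + g * x)) +_) (m≡m%n+[m/n]*n N g) ⟩
      P + (x + g * (0 + g * x)) + (N % g + N / g * g) ≡⟨ x0x+ye≡xyx+e g P x (N / g) (N % g) ⟩
      P + (x + g * (N / g + g * x)) + N % g      ∎)
    where
    open ≡-Reasoning
    P = p + g * (q + g * (q + g * p))
    N<g*g : N < g * g
    N<g*g = +-cancelˡ-< s N (g * g) (subst (_< s + g * g) (sym s+N≡t) t<s+g*g)

  case-B≥C+3 : ∀ {A B C D} → 0 < A → A < g → B < g → D < g → C + 3 ≤ B →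
               SumOfThreePalindromes g (D + g * (C + g * (B + g * A)))
  case-B≥C+3 {A} {B} {C} {D} 0<A A<g B<g D<g C+3≤B with m≤n⇒∃[o]m+o≡n C+3≤B
  ... | b , refl = via-pqqp+x0x 0<A A<g q<g z<s 1<g s≤t t<s+g*g (shape g A C D b)
    where
    shape : ∀ g A C D b →
      (D + g * (C + g * ((C + 3 + b) + g * A))) + (suc A + (1 + b) * g)
        ≡ (A + g * ((C + 1 + b) + g * ((C + 1 + b) + g * A))) + (1 + g * (0 + g * 1)) + (D + g * g)
    shape = solve-∀
    q<g : C + 1 + b < g
    q<g = <-trans (+-monoˡ-< b (+-monoʳ-< C (s≤s (s≤s z≤n)))) B<g
    2+b≤g : 2 + b ≤ g
    2+b≤g = ≤-trans (+-monoˡ-≤ b (≤-trans (s≤s (s≤s z≤n)) (m≤n+m 3 C))) (<⇒≤ B<g)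
    s≤t : suc A + (1 + b) * g ≤ D + g * g
    s≤t = begin
      suc A + (1 + b) * g  ≤⟨ +-monoˡ-≤ _ A<g ⟩
      (2 + b) * g          ≤⟨ *-monoˡ-≤ g 2+b≤g ⟩
      g * g                ≤⟨ m≤n+m _ D ⟩
      D + g * g            ∎
      where open ≤-Reasoning
    t<s+g*g : D + g * g < suc A + (1 + b) * g + g * g
    t<s+g*g = +-monoˡ-< (g * g) (<-≤-trans D<g (≤-trans (m≤m+n g (b * g)) (m≤n+m _ (suc A))))

  case-A+B≤CD : ∀ {A B C D} → 0 < A → A < g → 0 < B → B < g → C < g → D < g → A + B ≤ D + g * C →
                SumOfThreePalindromes g (D + g * (C + g * (B + g * A)))
  case-A+B≤CD {A} {B} {C} {D} 0<A A<g 0<B B<g C<g D<g A+B≤CD =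
    via-pqqp+x0x 0<A A<g (<-trans z<s 1<g) 0<B B<g A+B≤CD
      (<-≤-trans (d+g*m<g*n D<g C<g) (m≤n+m _ (A + B))) (shape g A B C D)
    where
    shape : ∀ g A B C D →
      (D + g * (C + g * (B + g * A))) + (A + B)
        ≡ (A + g * (0 + g * (0 + g * A))) + (B + g * (0 + g * B)) + (D + g * C)
    shape = solve-∀

  case-A≥2-B≡0-C≥3 : ∀ {A C D} → 1 < A → A < g → 3 ≤ C → C < g → D < g →
                     SumOfThreePalindromes g (D + g * (C + g * (0 + g * A)))
  case-A≥2-B≡0-C≥3 {suc p} {C} {D} (s≤s 0<p) A<g 3≤C C<g D<g with m≤n⇒∃[o]m+o≡n 3≤C
  ... | c , refl with m≤n⇒∃[o]m+o≡n C<g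
  ...   | u , refl =
    via-pqqp+x0x 0<p p<g q<g z<s x<g s≤t t<s+g*g (shape p c u D)
    where
    shape : ∀ p c u D → let g = 4 + c + u in
      (D + g * ((3 + c) + g * (0 + g * suc p))) + p
        ≡ (p + g * (suc c + g * (suc c + g * p))) + ((3 + u) + g * (0 + g * (3 + u))) + (g + (suc c + D))
    shape = solve-∀
    p<g : p < g
    p<g = <-trans (n<1+n p) A<g
    q<g : suc c < g
    q<g = ≤-<-trans (m≤n+m (suc c) 2) C<g
    x<g : 3 + u < g
    x<g = s≤s (s≤s (s≤s (s≤s (m≤n+m u c))))
    s≤t : p ≤ g + (suc c + D)
    s≤t = ≤-trans (<⇒≤ p<g) (m≤m+n g _)
    t<s+g*g : g + (suc c + D) < p + g * g
    t<s+g*g = begin-strict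
      g + (suc c + D)  <⟨ +-monoʳ-< g (+-mono-< q<g D<g) ⟩
      g + (g + g)      ≡⟨ cong (λ m → g + (g + m)) (+-identityʳ g) ⟨
      3 * g            ≤⟨ *-monoˡ-≤ g 3≤g ⟩
      g * g            ≤⟨ m≤n+m _ p ⟩
      p + g * g        ∎
      where
      open ≤-Reasoning
      3≤g : 3 ≤ g
      3≤g = s≤s (s≤s (s≤s z≤n))

  case-A≥2-B≤g-2-C≤g-3 : ∀ {A B C D} → 1 < A → A < g → suc B < g → 3 + C ≤ g → D < g →
                   SumOfThreePalindromes g (D + g * (C + g * (B + g * A)))
  case-A≥2-B≤g-2-C≤g-3 {suc p} {B} {C} {D} (s≤s 0<p) A<g x<g 3+C≤g D<g with m≤n⇒∃[o]m+o≡n 1<g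
  ... | h , refl =
    via-pqqp+x0x 0<p (<-trans (n<1+n p) A<g) (m<n+m h z<s) z<s x<g s≤t t<s+g*g (shape p h B C D)
    where
    shape : ∀ p h B C D → let g = 2 + h in
      (D + g * (C + g * (B + g * suc p))) + (suc p + B)
        ≡ (p + g * (h + g * (h + g * p))) + (suc B + g * (0 + g * suc B)) + ((2 + C) * g + D)
    shape = solve-∀
    s≤t : suc p + B ≤ (2 + C) * g + D
    s≤t = begin
      suc p + B      ≤⟨ +-mono-≤ (<⇒≤ A<g) (<⇒≤ (<-trans (n<1+n B) x<g)) ⟩
      g + g          ≤⟨ +-monoʳ-≤ g (m≤m+n g (C * g)) ⟩
      (2 + C) * g    ≤⟨ m≤m+n _ D ⟩
      (2 + C) * g + D ∎
      where open ≤-Reasoning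
    t<s+g*g : (2 + C) * g + D < suc p + B + g * g
    t<s+g*g = begin-strict
      (2 + C) * g + D  <⟨ +-monoʳ-< _ D<g ⟩
      (2 + C) * g + g  ≡⟨ +-comm _ g ⟩
      (3 + C) * g      ≤⟨ *-monoˡ-≤ g 3+C≤g ⟩
      g * g            ≤⟨ m≤n+m _ (suc p + B) ⟩
      suc p + B + g * g ∎
      where open ≤-Reasoning

  case-1-0-0-D : ∀ {D} → D < g → SumOfThreePalindromes g (D + g * (0 + g * (0 + g * 1)))
  case-1-0-0-D {D} D<g with m≤n⇒∃[o]m+o≡n 1<g
  ... | k , refl =
    suc k + g * (suc k + g * suc k) , 1 , D ,
    palindrome₃ g 1<g z<s h<g h<g , digit-palindrome g 1<g 1<g , digit-palindrome g 1<g D<g ,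
    shape (suc k) D
    where
    shape : ∀ h D → let g = suc h in
      D + g * (0 + g * (0 + g * 1)) ≡ (h + g * (h + g * h)) + 1 + D
    shape = solve-∀
    h<g : suc k < g
    h<g = n<1+n (suc k)

  case-1-0-C-D : ∀ {c D} → suc c < g → D < g → SumOfThreePalindromes g (D + g * (suc c + g * (0 + g * 1)))
  case-1-0-C-D {c} {D} C<g D<g with m≤n⇒∃[o]m+o≡n 1<g
  ... | k , refl =
    suc k + g * (c + g * suc k) , 1 + g * (0 + g * 1) , D ,
    palindrome₃ g 1<g z<s h<g (<-trans (n<1+n c) C<g) , palindrome₃ g 1<g z<s 1<g z<s ,
    digit-palindrome g 1<g D<g ,
    shape (suc k) c D
    where
    shape : ∀ h c D → let g = suc h in
      D + g * (suc c + g * (0 + g * 1)) ≡ (h + g * (c + g * h)) + (1 + g * (0 + g * 1)) + D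
    shape = solve-∀
    h<g : suc k < g
    h<g = n<1+n (suc k)

  case-1-B-0-D : ∀ {B D} → 0 < B → B < g → B ≤ suc D → D < g →
                 SumOfThreePalindromes g (D + g * (0 + g * (B + g * 1)))
  case-1-B-0-D {B} {D} 0<B B<g B≤1+D D<g with m≤n⇒∃[o]m+o≡n 1<g | m≤n⇒∃[o]m+o≡n B≤1+D
  ... | k , refl | e , B+e≡1+D =
    suc k + g * (suc k + g * suc k) , B + g * (0 + g * B) , e ,
    palindrome₃ g 1<g z<s h<g h<g , palindrome₃ g 1<g 0<B B<g z<s , digit-palindrome g 1<g e<g ,
    cancel-offset (shape (suc k) B D) B+e≡1+D
    where
    shape : ∀ h B D → let g = suc h in
      (D + g * (0 + g * (B + g * 1))) + B ≡ (h + g * (h + g * h)) + (B + g * (0 + g * B)) + suc D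
    shape = solve-∀
    h<g : suc k < g
    h<g = n<1+n (suc k)
    e<g : e < g
    e<g = ≤-trans (+-monoˡ-≤ e 0<B) (subst (_≤ g) (sym B+e≡1+D) D<g)

  case-1-2-0-0 : 2 < g → SumOfThreePalindromes g (0 + g * (0 + g * (2 + g * 1)))
  case-1-2-0-0 2<g with m≤n⇒∃[o]m+o≡n 2<g
  ... | k , refl =
    1 + g * (0 + g * (0 + g * 1)) , 1 + g * (1 + g * 1) , suc k + g * suc k ,
    palindrome₄ g 1<g z<s 1<g z<s , palindrome₃ g 1<g z<s 1<g 1<g , palindrome₂ g 1<g z<s h<g ,
    shape (suc k)
    where
    shape : ∀ h → let g = 2 + h in
      0 + g * (0 + g * (2 + g * 1)) ≡ (1 + g * (0 + g * (0 + g * 1))) + (1 + g * (1 + g * 1)) + (h + g * h)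
    shape = solve-∀
    h<g : suc k < g
    h<g = m<n+m (suc k) {2} z<s

module _ (g : ℕ) .{{_ : NonZero g}} (5≤g : 5 ≤ g) where

  private
    1<g : 1 < g
    1<g = ≤-trans (s≤s (s≤s z≤n)) 5≤g

    2<g : 2 < g
    2<g = ≤-trans (s≤s (s≤s (s≤s z≤n))) 5≤g

  leading-digit-one : ∀ {B C D} → B < g → C < g → D < g →
                      SumOfThreePalindromes g (D + g * (C + g * (B + g * 1)))
  leading-digit-one {B} {C} {D} B<g C<g D<g with C + 3 ≤? B
  ... | yes C+3≤B = case-B≥C+3 g 1<g z<s 1<g B<g D<g C+3≤B
  leading-digit-one {zero}  {zero}  _ _   D<g | no _ = case-1-0-0-D g 1<g D<g
  leading-digit-one {zero}  {suc c} _ C<g D<g | no _ = case-1-0-C-D g 1<g C<g D<g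
  leading-digit-one {suc b} {suc c} {D} B<g C<g D<g | no _ =
    case-A+B≤CD g 1<g z<s 1<g z<s B<g C<g D<g
      (≤-trans B<g (≤-trans (m≤m*n g (suc c)) (m≤n+m _ D)))
  leading-digit-one {suc b} {zero} {D} B<g _ D<g | no B≱3 with suc b ≤? suc D
  ... | yes B≤1+D = case-1-B-0-D g 1<g z<s B<g B≤1+D D<g
  leading-digit-one {1}                 {zero} {D}     _ _ _ | no _  | no 1≰1+D = contradiction (s≤s z≤n) 1≰1+D
  leading-digit-one {2}                 {zero} {zero}  _ _ _ | no _  | no _     = case-1-2-0-0 g 1<g 2<g
  leading-digit-one {2}                 {zero} {suc D} _ _ _ | no _  | no 2≰2+D = contradiction (s≤s (s≤s z≤n)) 2≰2+D
  leading-digit-one {suc (suc (suc b))} {zero} {D}     _ _ _ | no B≱3 | no _    = contradiction (s≤s (s≤s (s≤s z≤n))) B≱3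

  leading-digit-≥2 : ∀ {A B C D} → 1 < A → A < g → B < g → C < g → D < g →
                     SumOfThreePalindromes g (D + g * (C + g * (B + g * A)))
  leading-digit-≥2 {A} {B} {C} {D} 1<A A<g B<g C<g D<g with C + 3 ≤? B
  ... | yes C+3≤B = case-B≥C+3 g 1<g (<-trans z<s 1<A) A<g B<g D<g C+3≤B
  leading-digit-≥2 {A} {zero} {C} {D} 1<A A<g _ C<g D<g | no _ with 3 ≤? C
  ... | yes 3≤C = case-A≥2-B≡0-C≥3 g 1<g 1<A A<g 3≤C C<g D<g
  ... | no 3≰C  = case-A≥2-B≤g-2-C≤g-3 g 1<g 1<A A<g 1<g (≤-trans (+-monoʳ-≤ 3 (≤-pred (≰⇒> 3≰C))) 5≤g) D<g
  leading-digit-≥2 {A} {suc b} {C} {D} 1<A A<g B<g C<g D<g | no C+3≰B with A + suc b ≤? D + g * C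
  ... | yes A+B≤CD = case-A+B≤CD g 1<g (<-trans z<s 1<A) A<g z<s B<g C<g D<g A+B≤CD
  ... | no A+B≰CD  = case-A≥2-B≤g-2-C≤g-3 g 1<g 1<A A<g
                       (≤-trans (s≤s (≤-trans (≰⇒> C+3≰B) (+-monoˡ-≤ 3 C≤1))) 5≤g)
                       (≤-trans (+-monoʳ-≤ 3 C≤1) (≤-trans (n≤1+n 4) 5≤g)) D<g
    where
    A+B<g*2 : A + suc b < g * 2
    A+B<g*2 = begin-strict
      A + suc b  <⟨ +-mono-< A<g B<g ⟩
      g + g      ≡⟨ cong (g +_) (*-identityʳ g) ⟨
      g + g * 1  ≡⟨ *-suc g 1 ⟨
      g * 2      ∎
      where open ≤-Reasoning
    C≤1 : C ≤ 1
    C≤1 = ≤-pred (d+g*m<g*n⇒m<n {g} {D} (<-trans (≰⇒> A+B≰CD) A+B<g*2))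

  four-digit-sum : ∀ {A B C D} → 0 < A → A < g → B < g → C < g → D < g →
                   SumOfThreePalindromes g (D + g * (C + g * (B + g * A)))
  four-digit-sum {1}           _ _   = leading-digit-one
  four-digit-sum {suc (suc _)} _ A<g = leading-digit-≥2 (s≤s (s≤s z≤n)) A<g

lemma4p4 : (g : ℕ) → .{{_ : NonZero g}} → 5 ≤ g → (n : ℕ) → g ^ 3 ≤ n → n < g ^ 4 →
    ∃[ a ] ∃[ b ] ∃[ c ] (IsPalindrome g a × IsPalindrome g b × IsPalindrome g c × n ≡ a + b + c)
lemma4p4 g 5≤g n g³≤n n<g⁴ =
  subst (SumOfThreePalindromes g) (sym n≡DCBA)
    (four-digit-sum g 5≤g 0<A A<g (m%n<n n₂ g) (m%n<n n₁ g) (m%n<n n g))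
  where
  n₁ = n / g
  n₂ = n₁ / g
  A  = n₂ / g
  n≡DCBA : n ≡ n % g + g * (n₁ % g + g * (n₂ % g + g * A))
  n≡DCBA = begin
    n                                             ≡⟨ m≡m%g+g*[m/g] n ⟩
    n % g + g * n₁                                ≡⟨ cong (λ m → n % g + g * m) (m≡m%g+g*[m/g] n₁) ⟩
    n % g + g * (n₁ % g + g * n₂)                 ≡⟨ cong (λ m → n % g + g * (n₁ % g + g * m)) (m≡m%g+g*[m/g] n₂) ⟩
    n % g + g * (n₁ % g + g * (n₂ % g + g * A))   ∎
    where open ≡-Reasoning
  A<g : A < g
  A<g = subst (A <_) (*-identityʳ g) (m<g*n⇒m/g<n (m<g*n⇒m/g<n (m<g*n⇒m/g<n n<g⁴)))
  0<A : 0 < A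
  0<A = g*n≤m⇒n≤m/g (g*n≤m⇒n≤m/g (g*n≤m⇒n≤m/g g³≤n))
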